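{- Let $n$ be a power of $2$, let $A,W\in\{0,1\}^{n\times n}$, let $f$ be the function computed by $W$ and let $N(f)$ be its nondeterministic communication complexity. Let $k\ge1$ and let $k'\ge k\cdot 2^{N(f)}$. If $U\in\{0,1\}^{n\times k'}$, $V\in\{0,1\}^{k'\times n}$ satisfy $$\|A\circ W-U\cdot V\|_0\le\min_{\hat U\in\{0,1\}^{n\times k'},\hat V\in\{0,1\}^{k'\times n}}\|A\circ W-\hat U\cdot\hat V\|_0+\Delta$$ for some $\Delta\ge0$, then $$\|W\circ(A-U\cdot V)\|_0\le 2^{N(f)}\cdot OPT+\Delta,$$ where $OPT=\min_{\hat U\in\{0,1\}^{n\times k},\hat V\in\{0,1\}^{k\times n}}\|W\circ(A-\hat U\cdot\hat V)\|_0$.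
   Context: Here $U\cdot V$ denotes Boolean matrix multiplication: $(U\cdot V)_{i,j}=\bigvee_{l}(U_{i,l}\wedge V_{l,j})$. $\|M\|_0$ is the number of nonzero entries of $M$, and $\circ$ the entrywise product. Rows and columns of $W$ are indexed by $x,y\in\{0,1\}^{\log n}$ and $f(x,y)=W_{x,y}$. The nondeterministic communication complexity $N(f)$ is the minimum number such that the communication matrix $W$ can be covered by $2^{N(f)}$ possibly overlapping combinatorial rectangles $S\times T$ ($S,T\subseteq\{0,1\}^{\log n}$) such that every $(x,y)$ with $f(x,y)=1$ lies in at least one rectangle and no $(x,y)$ with $f(x,y)=0$ lies in any rectangle. -}

module Defs where

open import Data.Nat using (ℕ; zero; suc; _+_; _*_; _^_; _≤_)
open import Data.Fin using (Fin; zero; suc)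
open import Data.Bool using (Bool; true; false; _∧_; _∨_; if_then_else_)
open import Data.Product using (Σ; _×_; ∃-syntax)
open import Relation.Binary.PropositionalEquality using (_≡_; _≢_)
open import Relation.Nullary using (Dec; does)
open import Data.Bool.Properties using () renaming (_≟_ to _≟ᴮ_)

Mat : ℕ → ℕ → Set
Mat a b = Fin a → Fin b → Bool

∑ : (n : ℕ) → (Fin n → ℕ) → ℕ
∑ zero    f = 0
∑ (suc n) f = f zero + ∑ n (λ i → f (suc i))

⋁ : (n : ℕ) → (Fin n → Bool) → Bool
⋁ zero    f = false
⋁ (suc n) f = f zero ∨ ⋁ n (λ i → f (suc i))

_·_ : {a k b : ℕ} → Mat a k → Mat k b → Mat a b
_·_ {k = k} U V i j = ⋁ k (λ l → U i l ∧ V l j)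

_∘ᴹ_ : {a b : ℕ} → Mat a b → Mat a b → Mat a b
(M ∘ᴹ M') i j = M i j ∧ M' i j

diff : Bool → Bool → ℕ
diff x y = if does (x ≟ᴮ y) then 0 else 1

-- ‖M - M'‖₀ : number of entries where M and M' differ
dist₀ : {a b : ℕ} → Mat a b → Mat a b → ℕ
dist₀ {a} {b} M M' = ∑ a (λ i → ∑ b (λ j → diff (M i j) (M' i j)))

-- ‖W ∘ (A - M)‖₀ : number of entries with W = 1 and A ≠ M
wdist₀ : {a b : ℕ} → Mat a b → Mat a b → Mat a b → ℕ
wdist₀ {a} {b} W A M =
  ∑ a (λ i → ∑ b (λ j → if W i j then diff (A i j) (M i j) else 0))

-- a cover of the 1-entries of W by r (possibly overlapping, possibly empty)
-- combinatorial rectangles S_t × T_t containing no 0-entry of W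
RectCover : {n : ℕ} → Mat n n → ℕ → Set
RectCover {n} W r =
  Σ (Fin r → Fin n → Bool) λ S → Σ (Fin r → Fin n → Bool) λ T →
    (∀ i j → W i j ≡ true → ∃[ t ] (S t i ≡ true × T t j ≡ true)) ×
    (∀ t i j → S t i ≡ true → T t j ≡ true → W i j ≡ true)

-- N is the nondeterministic communication complexity N(f) of f(x,y) = W_{x,y}:
-- the least N such that W can be covered by 2^N rectangles
IsNDCC : {n : ℕ} → Mat n n → ℕ → Set
IsNDCC W N = RectCover W (2 ^ N) × (∀ N' → RectCover W (2 ^ N') → N ≤ N')

module Submission where

-- Let S_t × T_t (t < r = 2^N) be a rectangle cover of the
-- 1-entries of W.  For any Boolean matrix M = Û · V̂ of inner dimension k,
-- the masked matrix M ∘ W is again a Boolean product, of inner dimension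
-- k · r: use the columns Û_l ∧ S_t and the rows V̂_l ∧ T_t for all pairs
-- (l , t).  Padding with zero columns/rows this product has inner dimension
-- k'.  Then, writing d(X) = ‖A ∘ W − X‖₀ and using that U · V is
-- Δ-optimal for d among products of inner dimension k',
--   ‖W ∘ (A − U·V)‖₀ ≤ d(U·V) ≤ d(M ∘ W) + Δ = ‖W ∘ (A − M)‖₀ + Δ,
-- which is even stronger than the claimed bound with factor 2^N.

open import Defs
open import Data.Nat using (ℕ; zero; suc; _+_; _*_; _^_; _≤_; _<_; z≤n; _<?_)
open import Data.Nat.Properties using (≤-refl; +-mono-≤; +-monoˡ-≤; m≤n*m; m^n≢0; module ≤-Reasoning)
open import Data.Fin using (Fin; zero; suc; toℕ; fromℕ<; inject≤; combine; remQuot)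
open import Data.Fin.Properties using (toℕ-injective; toℕ-fromℕ<; toℕ-inject≤; toℕ<n; remQuot-combine)
open import Data.Bool using (Bool; true; false; _∧_; if_then_else_)
open import Data.Bool.Properties using (∧-identityʳ; ∧-zeroʳ)
open import Data.Product using (Σ; _×_; _,_; proj₁; proj₂; ∃-syntax)
open import Relation.Nullary using (yes; no; contradiction)
open import Relation.Binary.PropositionalEquality using (_≡_; refl; sym; trans; cong; cong₂; subst)

∑-cong : ∀ n {f g : Fin n → ℕ} → (∀ i → f i ≡ g i) → ∑ n f ≡ ∑ n g
∑-cong zero    f≡g = refl
∑-cong (suc n) f≡g = cong₂ _+_ (f≡g zero) (∑-cong n (λ i → f≡g (suc i)))

∑-mono : ∀ n {f g : Fin n → ℕ} → (∀ i → f i ≤ g i) → ∑ n f ≤ ∑ n g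
∑-mono zero    f≤g = z≤n
∑-mono (suc n) f≤g = +-mono-≤ (f≤g zero) (∑-mono n (λ i → f≤g (suc i)))

⋁-intro : ∀ n (f : Fin n → Bool) l → f l ≡ true → ⋁ n f ≡ true
⋁-intro (suc n) f zero    fl rewrite fl = refl
⋁-intro (suc n) f (suc l) fl with f zero
... | true  = refl
... | false = ⋁-intro n (λ i → f (suc i)) l fl

⋁-elim : ∀ n (f : Fin n → Bool) → ⋁ n f ≡ true → ∃[ l ] f l ≡ true
⋁-elim (suc n) f ⋁f with f zero in f0
... | true  = zero , f0
... | false with ⋁-elim n (λ i → f (suc i)) ⋁f
... | l , fl = suc l , fl

bool-ext : ∀ {a b : Bool} → (a ≡ true → b ≡ true) → (b ≡ true → a ≡ true) → a ≡ b
bool-ext {true}  a→b b→a = sym (a→b refl)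
bool-ext {false} {true}  a→b b→a = b→a refl
bool-ext {false} {false} a→b b→a = refl

∧-elim : ∀ {a b} → a ∧ b ≡ true → a ≡ true × b ≡ true
∧-elim {true} {true} _ = refl , refl

∧-intro : ∀ {a b} → a ≡ true → b ≡ true → a ∧ b ≡ true
∧-intro refl refl = refl

·-intro : ∀ {a p b} (U : Mat a p) (V : Mat p b) {i j} l →
          U i l ≡ true → V l j ≡ true → (U · V) i j ≡ true
·-intro {p = p} U V l u v = ⋁-intro p _ l (∧-intro u v)

·-elim : ∀ {a p b} (U : Mat a p) (V : Mat p b) {i j} →
         (U · V) i j ≡ true → ∃[ l ] (U i l ≡ true × V l j ≡ true)
·-elim {p = p} U V uv with ⋁-elim p _ uv
... | l , ul∧vl = l , ∧-elim ul∧vl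

BoolRank≤ : {a b : ℕ} → Mat a b → ℕ → Set
BoolRank≤ {a} {b} M p =
  Σ (Mat a p) λ U → Σ (Mat p b) λ V → ∀ i j → (U · V) i j ≡ M i j

rank-pad : ∀ {a b p q} {M : Mat a b} → p ≤ q → BoolRank≤ M p → BoolRank≤ M q
rank-pad {a} {b} {p} {q} {M} p≤q (U , V , UV≡M) = U' , V' , λ i j → trans (U'V'≡UV i j) (UV≡M i j)
  where
  U' : Mat a q
  U' i c with toℕ c <? p
  ... | yes c<p = U i (fromℕ< c<p)
  ... | no  _   = false

  V' : Mat q b
  V' c j with toℕ c <? p
  ... | yes c<p = V (fromℕ< c<p) j
  ... | no  _   = false

  -- a witness c of the padded product is one of the first p indices
  restrict : ∀ i j c → U' i c ≡ true → V' c j ≡ true → (U · V) i j ≡ true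
  restrict i j c u' v' with toℕ c <? p
  ... | yes c<p = ·-intro U V (fromℕ< c<p) u' v'

  embed : ∀ i j l → U i l ≡ true → V l j ≡ true →
          U' i (inject≤ l p≤q) ≡ true × V' (inject≤ l p≤q) j ≡ true
  embed i j l u v with toℕ (inject≤ l p≤q) <? p
  ... | yes l<p rewrite toℕ-injective (trans (toℕ-fromℕ< l<p) (toℕ-inject≤ l p≤q)) = u , v
  ... | no  l≮p = contradiction (subst (_< p) (sym (toℕ-inject≤ l p≤q)) (toℕ<n l)) l≮p

  U'V'≡UV : ∀ i j → (U' · V') i j ≡ (U · V) i j
  U'V'≡UV i j = bool-ext
    (λ u'v' → let c , u' , v' = ·-elim U' V' u'v' in restrict i j c u' v')
    (λ uv → let l , u , v = ·-elim U V uv ; u' , v' = embed i j l u v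
            in ·-intro U' V' (inject≤ l p≤q) u' v')

-- The index (l , t) uses the
-- column U_l restricted to S_t and the row V_l restricted to T_t.
rank-mask : ∀ {n k r} {M W : Mat n n} → RectCover W r → BoolRank≤ M k →
            BoolRank≤ (M ∘ᴹ W) (k * r)
rank-mask {n} {k} {r} {M} {W} (S , T , covers , inside) (U , V , UV≡M) =
  U' , V' , λ i j → trans (U'V'≡ i j) (cong (_∧ W i j) (UV≡M i j))
  where
  column : Fin n → Fin k × Fin r → Bool
  column i (l , t) = U i l ∧ S t i

  row : Fin n → Fin k × Fin r → Bool
  row j (l , t) = V l j ∧ T t j

  U' : Mat n (k * r)
  U' i c = column i (remQuot r c)

  V' : Mat (k * r) n
  V' c j = row j (remQuot r c)

  -- a pair (l , t) hits only entries of U · V lying in the rectangle S_t × T_t ⊆ W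
  sound : ∀ i j lt → column i lt ≡ true → row j lt ≡ true → (U · V) i j ∧ W i j ≡ true
  sound i j (l , t) ul∧s vl∧t =
    let u , s = ∧-elim ul∧s ; v , t' = ∧-elim vl∧t
    in ∧-intro (·-intro U V l u v) (inside t i j s t')

  -- an entry of U · V inside W is hit by its witness l and a rectangle t covering it
  complete : ∀ i j → (U · V) i j ∧ W i j ≡ true → (U' · V') i j ≡ true
  complete i j uvw with ∧-elim uvw
  ... | uv , w with ·-elim U V uv | covers i j w
  ... | l , u , v | t , s , t' =
    ·-intro U' V' (combine l t)
      (subst (λ lt → column i lt ≡ true) (sym (remQuot-combine l t)) (∧-intro u s))
      (subst (λ lt → row j lt ≡ true) (sym (remQuot-combine l t)) (∧-intro v t'))

  U'V'≡ : ∀ i j → (U' · V') i j ≡ (U · V) i j ∧ W i j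
  U'V'≡ i j = bool-ext
    (λ u'v' → let c , u' , v' = ·-elim U' V' u'v' in sound i j (remQuot r c) u' v')
    (complete i j)

dist₀-congʳ : ∀ {a b} (A : Mat a b) {M M' : Mat a b} → (∀ i j → M i j ≡ M' i j) →
              dist₀ A M ≡ dist₀ A M'
dist₀-congʳ {a} {b} A M≡M' = ∑-cong a λ i → ∑-cong b λ j → cong (diff (A i j)) (M≡M' i j)

diff-masked : ∀ a w x → diff (a ∧ w) (x ∧ w) ≡ (if w then diff a x else 0)
diff-masked a true  x rewrite ∧-identityʳ a | ∧-identityʳ x = refl
diff-masked a false x rewrite ∧-zeroʳ a | ∧-zeroʳ x = refl

diff-masked-≤ : ∀ a w x → (if w then diff a x else 0) ≤ diff (a ∧ w) x
diff-masked-≤ a true  x rewrite ∧-identityʳ a = ≤-refl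
diff-masked-≤ a false x = z≤n

dist₀-masked : ∀ {a b} (W A M : Mat a b) → dist₀ (A ∘ᴹ W) (M ∘ᴹ W) ≡ wdist₀ W A M
dist₀-masked {a} {b} W A M =
  sym (∑-cong a λ i → ∑-cong b λ j → sym (diff-masked (A i j) (W i j) (M i j)))

wdist₀≤dist₀ : ∀ {a b} (W A M : Mat a b) → wdist₀ W A M ≤ dist₀ (A ∘ᴹ W) M
wdist₀≤dist₀ {a} {b} W A M =
  ∑-mono a λ i → ∑-mono b λ j → diff-masked-≤ (A i j) (W i j) (M i j)

theorem4 : (m : ℕ) → (A W : Mat (2 ^ m) (2 ^ m)) → (N : ℕ) → IsNDCC W N →
    (k k' : ℕ) → 1 ≤ k → k * 2 ^ N ≤ k' →
    (U : Mat (2 ^ m) k') → (V : Mat k' (2 ^ m)) → (Δ : ℕ) →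
    (∀ (Û : Mat (2 ^ m) k') (V̂ : Mat k' (2 ^ m)) →
      dist₀ (A ∘ᴹ W) (U · V) ≤ dist₀ (A ∘ᴹ W) (Û · V̂) + Δ) →
    ∀ (Û : Mat (2 ^ m) k) (V̂ : Mat k (2 ^ m)) →
      wdist₀ W A (U · V) ≤ 2 ^ N * wdist₀ W A (Û · V̂) + Δ
theorem4 m A W N (cover , _) k k' _ k2ᴺ≤k' U V Δ UV-optimal Û V̂ = begin
  wdist₀ W A (U · V)                 ≤⟨ wdist₀≤dist₀ W A (U · V) ⟩
  dist₀ (A ∘ᴹ W) (U · V)             ≤⟨ UV-optimal U' V' ⟩
  dist₀ (A ∘ᴹ W) (U' · V') + Δ       ≡⟨ cong (_+ Δ) (dist₀-congʳ (A ∘ᴹ W) U'V'≡M∘W) ⟩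
  dist₀ (A ∘ᴹ W) (M ∘ᴹ W) + Δ        ≡⟨ cong (_+ Δ) (dist₀-masked W A M) ⟩
  wdist₀ W A M + Δ                   ≤⟨ +-monoˡ-≤ Δ (m≤n*m (wdist₀ W A M) (2 ^ N) {{m^n≢0 2 N}}) ⟩
  2 ^ N * wdist₀ W A M + Δ           ∎
  where
  open ≤-Reasoning
  M : Mat (2 ^ m) (2 ^ m)
  M = Û · V̂

  masked : BoolRank≤ (M ∘ᴹ W) k'
  masked = rank-pad k2ᴺ≤k' (rank-mask cover (Û , V̂ , λ _ _ → refl))

  U' : Mat (2 ^ m) k'
  U' = masked .proj₁

  V' : Mat k' (2 ^ m)
  V' = masked .proj₂ .proj₁

  U'V'≡M∘W : ∀ i j → (U' · V') i j ≡ (M ∘ᴹ W) i j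
  U'V'≡M∘W = masked .proj₂ .proj₂
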